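{- Let $p$ be an odd prime. The number $N^{(2)}(p)$ of Diophantine pairs in $\mathbb{F}_p$ is $\frac{(p-1)(p-2)}{4}$ if $p\equiv 1\pmod 4$ and $\frac{p^2-3p+4}{4}$ if $p\equiv 3\pmod 4$.
   Context: A Diophantine pair in $\mathbb{F}_p$ is a set $\{a,b\}$ of two distinct nonzero elements of $\mathbb{F}_p$ such that $ab+1$ is a square in $\mathbb{F}_p$ ($0$ counts as a square). -}

module Defs where

open import Data.Nat using (ℕ; zero; suc; _+_; _*_; _<_; _<?_; NonZero)
open import Data.Nat.DivMod using (_%_)
open import Data.Nat.Properties using (_≟_)
open import Data.Fin using (Fin; toℕ)
open import Data.Fin.Properties using (any?)
open import Data.List using (List; []; _∷_; map; concatMap; upTo; filter; length)
open import Data.Product using (_×_; _,_; ∃; proj₁; proj₂)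
open import Relation.Nullary using (Dec)
open import Relation.Nullary.Decidable using (_×-dec_)

-- Elements of 𝔽_p are represented by residues 0,1,…,p-1 (natural numbers < p),
-- with arithmetic taken modulo p.

IsSquareMod : (p : ℕ) .{{_ : NonZero p}} → ℕ → Set
IsSquareMod p c = ∃ λ (x : Fin p) → (toℕ x * toℕ x) % p ≡ c % p
  where open import Relation.Binary.PropositionalEquality using (_≡_)

isSquareMod? : (p : ℕ) .{{_ : NonZero p}} → (c : ℕ) → Dec (IsSquareMod p c)
isSquareMod? p c = any? (λ x → ((toℕ x * toℕ x) % p) ≟ (c % p))

-- All candidate unordered pairs {a,b} of distinct residues, listed as (a , b)
-- with a < b < p (each 2-element subset of 𝔽_p appears exactly once).
orderedPairs : ℕ → List (ℕ × ℕ)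
orderedPairs p = concatMap (λ b → map (λ a → (a , b)) (upTo b)) (upTo p)

-- {a,b} (a < b) is a Diophantine pair in 𝔽_p: a, b nonzero (b > a ≥ 1 forces
-- b nonzero too) and ab+1 is a square in 𝔽_p.
IsDiophantinePair : (p : ℕ) .{{_ : NonZero p}} → ℕ × ℕ → Set
IsDiophantinePair p (a , b) = (0 < a) × IsSquareMod p (a * b + 1)

isDiophantinePair? : (p : ℕ) .{{_ : NonZero p}} → (ab : ℕ × ℕ) → Dec (IsDiophantinePair p ab)
isDiophantinePair? p (a , b) = (0 <? a) ×-dec isSquareMod? p (a * b + 1)

N2 : (p : ℕ) .{{_ : NonZero p}} → ℕ
N2 p = length (filter (isDiophantinePair? p) (orderedPairs p))

-- Let χ(c) ∈ {0,1} record whether c is a square in 𝔽_p (0 included).  A nonzero c has 2χ(c) square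
-- roots and 0 has one, so ∑_c χ(c) = (p+1)/2.  For a ≠ 0 the map b ↦ ab+1 permutes 𝔽_p, so every
-- row ∑_{b≠0} χ(ab+1) equals (p+1)/2 − χ(1) = (p−1)/2; summing over a ≠ 0 counts each Diophantine
-- pair twice and each diagonal entry χ(a²+1) once.  Counting solutions of x² − a² = 1 (substitute
-- x = a + u) gives 2 ∑_a χ(a²+1) = p − 1 + 2χ(−1).  Finally χ(−1) is read off from p mod 4 without
-- reciprocity: c ↦ c⁻¹ (with 0⁻¹ = 0) is an involution preserving χ whose fixed points are 0, 1 and
-- −1, so the number (p+1)/2 of squares is congruent to 2 + χ(−1) modulo 2.

module Submission where

open import Defs
open import Data.Bool using (if_then_else_)
open import Data.Empty using (⊥-elim)
open import Data.Fin using (Fin; toℕ; fromℕ<)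
open import Data.Fin.Permutation using (Permutation; permutation)
open import Data.Fin.Properties using (toℕ-injective; toℕ<n; toℕ-fromℕ<)
open import Data.List using (List; _++_; applyUpTo; concatMap; filter; length; map; upTo)
open import Data.List.Properties using (filter-++; length-++; map-applyUpTo)
open import Data.Nat using (ℕ; zero; suc; pred; NonZero; _+_; _*_; _∸_; _<_; _≤_; z<s; s<s; _<?_; >-nonZero⁻¹; nonTrivial⇒n>1; >-nonZero)
open import Data.Nat.Coprimality using (coprime-Bézout; prime⇒coprime)
open import Data.Nat.DivMod using (_%_; _/_; m%n%n≡m%n; %-distribˡ-+; %-distribˡ-*; m<n⇒m%n≡m; m%n<n; m%n≤n; [m+kn]%n≡m%n; m*n/n≡m)
open import Data.Nat.Divisibility using (_∣_; divides; ∣-refl; m%n≡0⇒n∣m; n∣m⇒m%n≡0; ∣⇒≤)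
open import Data.Nat.GCD using (module Bézout)
open import Data.Nat.Primality using (Prime; euclidsLemma; prime⇒nonTrivial)
open import Data.Nat.Properties using (_≟_; +-*-semiring; <-cmp; ≤-refl; ≤-total; ≤-antisym; <⇒≤pred; m≤pred[n]⇒suc[m]≤n; suc-pred; n≢0⇒n>0; ∸-monoʳ-<; m∸n+n≡m; m+[n∸m]≡n; m+n∸m≡n; +-identityʳ; +-comm; +-assoc; +-cancelʳ-≡; *-identityˡ; *-identityʳ; *-zeroʳ; *-comm; *-assoc; *-distribˡ-+; *-cancelˡ-≡)
open import Data.Nat.Solver using (module +-*-Solver)
open import Data.Product using (_×_; _,_; ∃; proj₁; proj₂)
open import Data.Sum using (_⊎_; inj₁; inj₂; [_,_])
import Data.Sum as Sum
open import Function using (_∘_; id; _⇔_; mk⇔; Equivalence)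
open import Relation.Binary using (Setoid; IsEquivalence; _Preserves_⟶_)
open import Relation.Binary.Definitions using (tri<; tri≈; tri>)
open import Relation.Binary.PropositionalEquality using (_≡_; _≢_; refl; sym; trans; cong; cong₂; subst; ≢-sym; module ≡-Reasoning)
import Relation.Binary.Reasoning.Setoid
open import Relation.Nullary using (Dec; yes; no; ¬_; does; contradiction)
open import Relation.Nullary.Decidable using (map′; _⊎-dec_)
open import Relation.Unary using (Decidable)
import Algebra.Properties.Semiring.Sum +-*-semiring as Σ
open +-*-Solver using (solve; _:+_; _:*_; _:=_; con)

-- Finite sums and indicators

∑ : ℕ → (ℕ → ℕ) → ℕ
∑ n f = Σ.sum {n} (f ∘ toℕ)

infixl 10 ∑
syntax ∑ n (λ i → e) = ∑[ i < n ] e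

∑-cong : ∀ n {f g : ℕ → ℕ} → (∀ i → i < n → f i ≡ g i) → ∑ n f ≡ ∑ n g
∑-cong n f≗g = Σ.sum-cong-≗ {n} (λ i → f≗g (toℕ i) (toℕ<n i))

∑-const : ∀ n c → ∑[ i < n ] c ≡ n * c
∑-const zero c = refl
∑-const (suc n) c = cong (c +_) (∑-const n c)

∑-zero : ∀ n {f : ℕ → ℕ} → (∀ i → i < n → f i ≡ 0) → ∑ n f ≡ 0
∑-zero n f≡0 = trans (∑-cong n f≡0) (trans (∑-const n 0) (*-zeroʳ n))

∑-pred : ∀ n .{{_ : NonZero n}} (f : ℕ → ℕ) → ∑ n f ≡ f 0 + ∑[ i < pred n ] f (suc i)
∑-pred (suc n) f = refl


module _ (n : ℕ) where

  ∑-distrib-+ : (f g : ℕ → ℕ) → ∑[ i < n ] (f i + g i) ≡ ∑ n f + ∑ n g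
  ∑-distrib-+ f g = Σ.∑-distrib-+ {n} (f ∘ toℕ) (g ∘ toℕ)

  *-distribˡ-∑ : ∀ c (f : ℕ → ℕ) → c * ∑ n f ≡ ∑[ i < n ] (c * f i)
  *-distribˡ-∑ c f = Σ.*-distribˡ-sum {n} c (f ∘ toℕ)

  ∑-comm : ∀ m (f : ℕ → ℕ → ℕ) → ∑[ i < n ] ∑[ j < m ] f i j ≡ ∑[ j < m ] ∑[ i < n ] f i j
  ∑-comm m f = Σ.∑-comm {n} {m} (λ i j → f (toℕ i) (toℕ j))

  ∑-bijection : (σ τ : ℕ → ℕ) → (∀ {i} → i < n → σ i < n) → (∀ {i} → i < n → τ i < n) →
                (∀ {i} → i < n → τ (σ i) ≡ i) → (∀ {i} → i < n → σ (τ i) ≡ i) →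
                (f : ℕ → ℕ) → ∑[ i < n ] f (σ i) ≡ ∑ n f
  ∑-bijection σ τ σ< τ< τσ στ f =
    sym (trans (Σ.sum-permute (f ∘ toℕ) π) (Σ.sum-cong-≗ {n} (λ i → cong f (toℕ-fromℕ< _))))
    where
    lift : (h : ℕ → ℕ) → (∀ {i} → i < n → h i < n) → Fin n → Fin n
    lift h h< i = fromℕ< (h< (toℕ<n i))
    π : Permutation n n
    π = permutation (lift σ σ<) (lift τ τ<)
          (λ i → toℕ-injective (trans (toℕ-fromℕ< _) (trans (cong σ (toℕ-fromℕ< _)) (στ (toℕ<n i)))))
          (λ i → toℕ-injective (trans (toℕ-fromℕ< _) (trans (cong τ (toℕ-fromℕ< _)) (τσ (toℕ<n i)))))

-- Defined from the boolean alone, so that e.g. 𝟙 (suc i ≟ suc j) and 𝟙 (i ≟ j) are definitionally equal.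
𝟙 : ∀ {a} {A : Set a} → Dec A → ℕ
𝟙 d = if does d then 1 else 0

𝟙-0⊎1 : ∀ {a} {A : Set a} (d : Dec A) → 𝟙 d ≡ 0 ⊎ 𝟙 d ≡ 1
𝟙-0⊎1 (yes _) = inj₂ refl
𝟙-0⊎1 (no _) = inj₁ refl

𝟙-yes : ∀ {a} {A : Set a} (d : Dec A) → A → 𝟙 d ≡ 1
𝟙-yes (yes _) _ = refl
𝟙-yes (no ¬x) x = ⊥-elim (¬x x)

𝟙-no : ∀ {a} {A : Set a} (d : Dec A) → ¬ A → 𝟙 d ≡ 0
𝟙-no (yes x) ¬x = ⊥-elim (¬x x)
𝟙-no (no _) _ = refl

𝟙-cong : ∀ {a b} {A : Set a} {B : Set b} (d : Dec A) (e : Dec B) → A ⇔ B → 𝟙 d ≡ 𝟙 e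
𝟙-cong (yes _) (yes _) _ = refl
𝟙-cong (no _) (no _) _ = refl
𝟙-cong (yes x) (no ¬y) A⇔B = ⊥-elim (¬y (Equivalence.to A⇔B x))
𝟙-cong (no ¬x) (yes y) A⇔B = ⊥-elim (¬x (Equivalence.from A⇔B y))

𝟙-⊎ : ∀ {a b c} {A : Set a} {B : Set b} {C : Set c} (d : Dec A) (e : Dec B) (f : Dec C) →
      A ⇔ (B ⊎ C) → (B → ¬ C) → 𝟙 d ≡ 𝟙 e + 𝟙 f
𝟙-⊎ d (yes y) (yes z) _ B→¬C = ⊥-elim (B→¬C y z)
𝟙-⊎ d (yes y) (no _) A⇔B⊎C _ = 𝟙-yes d (Equivalence.from A⇔B⊎C (inj₁ y))
𝟙-⊎ d (no _) (yes z) A⇔B⊎C _ = 𝟙-yes d (Equivalence.from A⇔B⊎C (inj₂ z))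
𝟙-⊎ d (no ¬y) (no ¬z) A⇔B⊎C _ = 𝟙-no d ([ ¬y , ¬z ] ∘ Equivalence.to A⇔B⊎C)

∑-δ : ∀ {n u} (f : ℕ → ℕ) → u < n → ∑[ i < n ] (𝟙 (i ≟ u) * f i) ≡ f u
∑-δ {suc n} {zero} f _ = trans (cong₂ _+_ (*-identityˡ (f 0)) (∑-zero n (λ _ _ → refl))) (+-identityʳ (f 0))
∑-δ {suc n} {suc u} f (s<s u<n) = ∑-δ {n} {u} (f ∘ suc) u<n

∑-𝟙-≟ : ∀ {n u} → u < n → ∑[ i < n ] 𝟙 (i ≟ u) ≡ 1
∑-𝟙-≟ {n} u<n = trans (∑-cong n (λ i _ → sym (*-identityʳ (𝟙 (i ≟ _))))) (∑-δ (λ _ → 1) u<n)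

𝟙-trichotomy : ∀ i j → 𝟙 (j ≟ i) + 𝟙 (i <? j) + 𝟙 (j <? i) ≡ 1
𝟙-trichotomy i j with <-cmp i j
... | tri< i<j i≢j j≮i = cong₂ _+_ (cong₂ _+_ (𝟙-no (j ≟ i) (≢-sym i≢j)) (𝟙-yes (i <? j) i<j)) (𝟙-no (j <? i) j≮i)
... | tri≈ i≮j i≡j j≮i = cong₂ _+_ (cong₂ _+_ (𝟙-yes (j ≟ i) (sym i≡j)) (𝟙-no (i <? j) i≮j)) (𝟙-no (j <? i) j≮i)
... | tri> i≮j i≢j j<i = cong₂ _+_ (cong₂ _+_ (𝟙-no (j ≟ i) (≢-sym i≢j)) (𝟙-no (i <? j) i≮j)) (𝟙-yes (j <? i) j<i)

∑-involution : ∀ {n} (ι : ℕ → ℕ) → (∀ {i} → i < n → ι i < n) → (∀ {i} → i < n → ι (ι i) ≡ i) →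
               (f : ℕ → ℕ) → (∀ {i} → i < n → f (ι i) ≡ f i) →
               ∑ n f ≡ ∑[ i < n ] (𝟙 (ι i ≟ i) * f i) + 2 * ∑[ i < n ] (𝟙 (i <? ι i) * f i)
∑-involution {n} ι ι< ιι f fι = begin
  ∑ n f                                   ≡⟨ ∑-cong n split ⟩
  ∑[ i < n ] (fixed i + up i + down i)    ≡⟨ ∑-distrib-+ n (λ i → fixed i + up i) down ⟩
  ∑[ i < n ] (fixed i + up i) + ∑ n down  ≡⟨ cong₂ _+_ (∑-distrib-+ n fixed up) down≡up ⟩
  ∑ n fixed + ∑ n up + ∑ n up             ≡⟨ solve 2 (λ a b → a :+ b :+ b := a :+ con 2 :* b) refl (∑ n fixed) (∑ n up) ⟩
  ∑ n fixed + 2 * ∑ n up                  ∎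
  where
  open ≡-Reasoning
  fixed up down : ℕ → ℕ
  fixed i = 𝟙 (ι i ≟ i) * f i
  up i = 𝟙 (i <? ι i) * f i
  down i = 𝟙 (ι i <? i) * f i
  split : ∀ i → i < n → f i ≡ fixed i + up i + down i
  split i _ = begin
    f i                                                ≡⟨ *-identityˡ (f i) ⟨
    1 * f i                                            ≡⟨ cong (_* f i) (𝟙-trichotomy i (ι i)) ⟨
    (𝟙 (ι i ≟ i) + 𝟙 (i <? ι i) + 𝟙 (ι i <? i)) * f i
      ≡⟨ solve 4 (λ a b c x → (a :+ b :+ c) :* x := a :* x :+ b :* x :+ c :* x) refl (𝟙 (ι i ≟ i)) (𝟙 (i <? ι i)) (𝟙 (ι i <? i)) (f i) ⟩
    fixed i + up i + down i ∎
  down≡up : ∑ n down ≡ ∑ n up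
  down≡up = trans (∑-cong n (λ i i<n → cong₂ _*_ (𝟙-cong (ι i <? i) (ι i <? ι (ι i)) (ιι-⇔ i<n)) (sym (fι i<n))))
                  (∑-bijection n ι ι ι< ι< ιι ιι up)
    where
    ιι-⇔ : ∀ {i} → i < n → (ι i < i) ⇔ (ι i < ι (ι i))
    ιι-⇔ {i} i<n = mk⇔ (subst (ι i <_) (sym (ιι i<n))) (subst (ι i <_) (ιι i<n))

∑-triangle : ∀ n (g : ℕ → ℕ → ℕ) → (∀ i j → g i j ≡ g j i) →
             2 * ∑[ j < n ] ∑[ i < j ] g i j + ∑[ i < n ] g i i ≡ ∑[ i < n ] ∑[ j < n ] g i j
∑-triangle zero g g-sym = refl
∑-triangle (suc n) g g-sym = begin
  2 * ∑[ j < n ] (g 0 (suc j) + T j) + (g 0 0 + D)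
    ≡⟨ cong (λ t → 2 * t + (g 0 0 + D)) (∑-distrib-+ n (g 0 ∘ suc) T) ⟩
  2 * (R + ∑ n T) + (g 0 0 + D)
    ≡⟨ solve 4 (λ r t d x → con 2 :* (r :+ t) :+ (x :+ d) := (x :+ r) :+ (r :+ (con 2 :* t :+ d))) refl R (∑ n T) D (g 0 0) ⟩
  (g 0 0 + R) + (R + (2 * ∑ n T + D))
    ≡⟨ cong₂ (λ r s → (g 0 0 + R) + (r + s)) (∑-cong n (λ j _ → g-sym 0 (suc j))) (∑-triangle n g′ (λ i j → g-sym (suc i) (suc j))) ⟩
  (g 0 0 + R) + (∑[ i < n ] g (suc i) 0 + ∑[ i < n ] ∑[ j < n ] g′ i j)
    ≡⟨ cong ((g 0 0 + R) +_) (sym (∑-distrib-+ n (λ i → g (suc i) 0) (λ i → ∑[ j < n ] g′ i j))) ⟩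
  (g 0 0 + R) + ∑[ i < n ] (g (suc i) 0 + ∑[ j < n ] g′ i j) ∎
  where
  open ≡-Reasoning
  g′ : ℕ → ℕ → ℕ
  g′ i j = g (suc i) (suc j)
  T : ℕ → ℕ
  T j = ∑[ i < j ] g′ i j
  R D : ℕ
  R = ∑[ j < n ] g 0 (suc j)
  D = ∑[ i < n ] g′ i i

module _ {a p} {A : Set a} {P : A → Set p} (P? : Decidable P) where

  length-filter-applyUpTo : ∀ (f : ℕ → A) n → length (filter P? (applyUpTo f n)) ≡ ∑[ i < n ] 𝟙 (P? (f i))
  length-filter-applyUpTo f zero = refl
  length-filter-applyUpTo f (suc n) with P? (f 0)
  ... | yes _ = cong suc (length-filter-applyUpTo (f ∘ suc) n)
  ... | no _ = length-filter-applyUpTo (f ∘ suc) n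

  length-filter-concatMap : ∀ (g : ℕ → List A) (f : ℕ → ℕ) n →
                            length (filter P? (concatMap g (applyUpTo f n))) ≡ ∑[ i < n ] length (filter P? (g (f i)))
  length-filter-concatMap g f zero = refl
  length-filter-concatMap g f (suc n) = begin
    length (filter P? (g (f 0) ++ rest))              ≡⟨ cong length (filter-++ P? (g (f 0)) rest) ⟩
    length (filter P? (g (f 0)) ++ filter P? rest)    ≡⟨ length-++ (filter P? (g (f 0))) ⟩
    length (filter P? (g (f 0))) + length (filter P? rest) ≡⟨ cong (length (filter P? (g (f 0))) +_) (length-filter-concatMap g (f ∘ suc) n) ⟩
    ∑[ i < suc n ] length (filter P? (g (f i))) ∎
    where
    open ≡-Reasoning
    rest : List A
    rest = concatMap g (applyUpTo (f ∘ suc) n)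

-- Arithmetic modulo p

module Residues (p : ℕ) .{{_ : NonZero p}} where

  infix 4 _≈_ _≉_ _≈?_

  0<p : 0 < p
  0<p = >-nonZero⁻¹ p

  -- A record rather than the bare equation x % p ≡ y % p, so that x and y can be inferred from a proof.
  record _≈_ (x y : ℕ) : Set where
    constructor mod
    field %-≡ : x % p ≡ y % p

  _≉_ : ℕ → ℕ → Set
  x ≉ y = ¬ x ≈ y

  ≈-isEquivalence : IsEquivalence _≈_
  ≈-isEquivalence = record
    { refl = mod refl
    ; sym = λ (mod e) → mod (sym e)
    ; trans = λ (mod e) (mod e′) → mod (trans e e′)
    }

  ≈-setoid : Setoid _ _
  ≈-setoid = record { isEquivalence = ≈-isEquivalence }

  open IsEquivalence ≈-isEquivalence public
    using () renaming (refl to ≈-refl; sym to ≈-sym; trans to ≈-trans; reflexive to ≈-reflexive)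

  _≈?_ : ∀ x y → Dec (x ≈ y)
  x ≈? y = map′ mod _≈_.%-≡ (x % p ≟ y % p)

  %-≈ : ∀ x → x % p ≈ x
  %-≈ x = mod (m%n%n≡m%n x p)

  +-cong : ∀ {a b c d} → a ≈ b → c ≈ d → a + c ≈ b + d
  +-cong {a} {b} {c} {d} (mod e) (mod e′) = mod (begin
    (a + c) % p                 ≡⟨ %-distribˡ-+ a c p ⟩
    (a % p + c % p) % p         ≡⟨ cong₂ (λ u v → (u + v) % p) e e′ ⟩
    (b % p + d % p) % p         ≡⟨ %-distribˡ-+ b d p ⟨
    (b + d) % p                 ∎)
    where open ≡-Reasoning

  *-cong : ∀ {a b c d} → a ≈ b → c ≈ d → a * c ≈ b * d
  *-cong {a} {b} {c} {d} (mod e) (mod e′) = mod (begin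
    (a * c) % p                 ≡⟨ %-distribˡ-* a c p ⟩
    (a % p * (c % p)) % p       ≡⟨ cong₂ (λ u v → (u * v) % p) e e′ ⟩
    (b % p * (d % p)) % p       ≡⟨ %-distribˡ-* b d p ⟨
    (b * d) % p                 ∎)
    where open ≡-Reasoning

  module ≈-Reasoning = Relation.Binary.Reasoning.Setoid ≈-setoid

  <p⇒%≡ : ∀ {x} → x < p → x % p ≡ x
  <p⇒%≡ = m<n⇒m%n≡m

  ≈⇒≡ : ∀ {x y} → x < p → y < p → x ≈ y → x ≡ y
  ≈⇒≡ x<p y<p (mod e) = trans (sym (<p⇒%≡ x<p)) (trans e (<p⇒%≡ y<p))

  ∣⇒≈0 : ∀ {x} → p ∣ x → x ≈ 0
  ∣⇒≈0 {x} p∣x = mod (trans (n∣m⇒m%n≡0 x p p∣x) (sym (<p⇒%≡ 0<p)))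

  ≈0⇒∣ : ∀ {x} → x ≈ 0 → p ∣ x
  ≈0⇒∣ {x} (mod e) = m%n≡0⇒n∣m x p (trans e (<p⇒%≡ 0<p))

  0<x<p⇒≉0 : ∀ {x} → 0 < x → x < p → x ≉ 0
  0<x<p⇒≉0 0<x x<p x≈0 with ≈⇒≡ x<p 0<p x≈0
  0<x<p⇒≉0 () x<p x≈0 | refl

  pred-p<p : pred p < p
  pred-p<p = m≤pred[n]⇒suc[m]≤n ≤-refl

  pred-p+1≈0 : pred p + 1 ≈ 0
  pred-p+1≈0 = ≈-trans (≈-reflexive (trans (+-comm (pred p) 1) (suc-pred p))) (∣⇒≈0 ∣-refl)

  *p≈0 : ∀ k → k * p ≈ 0
  *p≈0 k = ∣⇒≈0 (divides k refl)

  -_ : ℕ → ℕ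
  - x = p ∸ x % p

  +-inverseʳ : ∀ x → x + - x ≈ 0
  +-inverseʳ x = begin
    x + (p ∸ x % p)     ≈⟨ +-cong (≈-sym (%-≈ x)) ≈-refl ⟩
    x % p + (p ∸ x % p) ≡⟨ m+[n∸m]≡n (m%n≤n x p) ⟩
    p                   ≈⟨ ∣⇒≈0 ∣-refl ⟩
    0                   ∎
    where open ≈-Reasoning

  +-inverseˡ : ∀ x → - x + x ≈ 0
  +-inverseˡ x = ≈-trans (≈-reflexive (+-comm (- x) x)) (+-inverseʳ x)

  ≉0⇒%>0 : ∀ {x} → x ≉ 0 → 0 < x % p
  ≉0⇒%>0 {x} x≉0 = n≢0⇒n>0 (λ x%p≡0 → x≉0 (mod (trans x%p≡0 (sym (<p⇒%≡ 0<p)))))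

  -‿< : ∀ {x} → x ≉ 0 → - x < p
  -‿< {x} x≉0 = ∸-monoʳ-< (≉0⇒%>0 x≉0) (m%n≤n x p)

  +-cancelʳ : ∀ {a b} c → a + c ≈ b + c → a ≈ b
  +-cancelʳ {a} {b} c e = begin
    a                 ≡⟨ +-identityʳ a ⟨
    a + 0             ≈⟨ +-cong ≈-refl (+-inverseʳ c) ⟨
    a + (c + - c)     ≡⟨ +-assoc a c (- c) ⟨
    a + c + - c       ≈⟨ +-cong e ≈-refl ⟩
    b + c + - c       ≡⟨ +-assoc b c (- c) ⟩
    b + (c + - c)     ≈⟨ +-cong ≈-refl (+-inverseʳ c) ⟩
    b + 0             ≡⟨ +-identityʳ b ⟩
    b                 ∎
    where open ≈-Reasoning

difference-of-squares : ∀ {x y} → y ≤ x → x * x ≡ (x ∸ y) * (x + y) + y * y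
difference-of-squares {x} {y} y≤x = begin
  x * x                             ≡⟨ cong (λ z → z * z) x≡d+y ⟩
  (d + y) * (d + y)                 ≡⟨ solve 2 (λ d y → (d :+ y) :* (d :+ y) := d :* ((d :+ y) :+ y) :+ y :* y) refl d y ⟩
  d * ((d + y) + y) + y * y         ≡⟨ cong (λ z → d * (z + y) + y * y) x≡d+y ⟨
  d * (x + y) + y * y               ∎
  where
  open ≡-Reasoning
  d : ℕ
  d = x ∸ y
  x≡d+y : x ≡ d + y
  x≡d+y = sym (m∸n+n≡m y≤x)

module PrimeField (p : ℕ) .{{_ : NonZero p}} (p-prime : Prime p) where

  open Residues p public
  open ≈-Reasoning

  1<p : 1 < p
  1<p = nonTrivial⇒n>1 p {{prime⇒nonTrivial p-prime}}

  *-≈0 : ∀ {a b} → a * b ≈ 0 → a ≈ 0 ⊎ b ≈ 0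
  *-≈0 {a} {b} ab≈0 = Sum.map ∣⇒≈0 ∣⇒≈0 (euclidsLemma a b p-prime (≈0⇒∣ ab≈0))

  +≈0⇒square≈ : ∀ {x y} → x + y ≈ 0 → x * x ≈ y * y
  +≈0⇒square≈ {x} {y} x+y≈0 = +-cancelʳ (x * y) (begin
    x * x + x * y     ≡⟨ *-distribˡ-+ x x y ⟨
    x * (x + y)       ≈⟨ *-cong (≈-refl {x}) x+y≈0 ⟩
    x * 0             ≡⟨ *-zeroʳ x ⟩
    0                 ≡⟨ *-zeroʳ y ⟨
    y * 0             ≈⟨ *-cong (≈-refl {y}) x+y≈0 ⟨
    y * (x + y)       ≡⟨ solve 2 (λ x y → y :* (x :+ y) := y :* y :+ x :* y) refl x y ⟩
    y * y + x * y     ∎)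

  square-roots-≤ : ∀ {x y} → y ≤ x → x * x ≈ y * y → x ≈ y ⊎ x + y ≈ 0
  square-roots-≤ {x} {y} y≤x x²≈y² = Sum.map₁ x≈y (*-≈0 (+-cancelʳ (y * y) (begin
    (x ∸ y) * (x + y) + y * y   ≡⟨ difference-of-squares y≤x ⟨
    x * x                       ≈⟨ x²≈y² ⟩
    0 + y * y                   ∎)))
    where
    x≈y : x ∸ y ≈ 0 → x ≈ y
    x≈y d≈0 = begin
      x             ≡⟨ m∸n+n≡m y≤x ⟨
      (x ∸ y) + y   ≈⟨ +-cong d≈0 ≈-refl ⟩
      y             ∎

  square-roots : ∀ x y → x * x ≈ y * y → x ≈ y ⊎ x + y ≈ 0
  square-roots x y x²≈y² with ≤-total y x
  ... | inj₁ y≤x = square-roots-≤ y≤x x²≈y²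
  ... | inj₂ x≤y = Sum.map ≈-sym (≈-trans (≈-reflexive (+-comm x y))) (square-roots-≤ x≤y (≈-sym x²≈y²))

  1≉0 : 1 ≉ 0
  1≉0 1≈0 with ≈⇒≡ 1<p 0<p 1≈0
  ... | ()

  *-inverse : ∀ {c} → c ≉ 0 → ∃ λ y → c * y ≈ 1
  *-inverse {c} c≉0 with coprime-Bézout (prime⇒coprime p-prime {{>-nonZero (≉0⇒%>0 c≉0)}} (m%n<n c p))
  ... | Bézout.-+ x y 1+xp≡yc = y , (begin
    c * y            ≈⟨ *-cong (%-≈ c) (≈-refl {y}) ⟨
    c % p * y        ≡⟨ *-comm (c % p) y ⟩
    y * (c % p)      ≡⟨ 1+xp≡yc ⟨
    1 + x * p        ≈⟨ +-cong (≈-refl {1}) (*p≈0 x) ⟩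
    1 + 0            ∎)
  ... | Bézout.+- x y 1+yc≡xp = y * (c * y) , (begin
    c * (y * (c * y))  ≡⟨ *-assoc c y (c * y) ⟨
    c * y * (c * y)    ≈⟨ +≈0⇒square≈ cy+1≈0 ⟩
    1 * 1              ∎)
    where
    cy+1≈0 : c * y + 1 ≈ 0
    cy+1≈0 = begin
      c * y + 1          ≈⟨ +-cong (*-cong (%-≈ c) (≈-refl {y})) (≈-refl {1}) ⟨
      c % p * y + 1      ≡⟨ solve 2 (λ r y → r :* y :+ con 1 := con 1 :+ y :* r) refl (c % p) y ⟩
      1 + y * (c % p)    ≡⟨ 1+yc≡xp ⟩
      x * p              ≈⟨ *p≈0 x ⟩
      0                  ∎

  infix 8 _⁻¹

  -- 0 ⁻¹ = 0; this makes _⁻¹ an involution of all of [0, p).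
  _⁻¹ : ℕ → ℕ
  c ⁻¹ with c ≈? 0
  ... | yes _ = 0
  ... | no c≉0 = proj₁ (*-inverse c≉0) % p

  ⁻¹<p : ∀ c → c ⁻¹ < p
  ⁻¹<p c with c ≈? 0
  ... | yes _ = 0<p
  ... | no c≉0 = m%n<n _ p

  ⁻¹-≈0 : ∀ {c} → c ≈ 0 → c ⁻¹ ≡ 0
  ⁻¹-≈0 {c} c≈0 with c ≈? 0
  ... | yes _ = refl
  ... | no c≉0 = contradiction c≈0 c≉0

  *-inverseʳ : ∀ {c} → c ≉ 0 → c * c ⁻¹ ≈ 1
  *-inverseʳ {c} c≉0 with c ≈? 0
  ... | yes c≈0 = contradiction c≈0 c≉0
  ... | no c≉0 = ≈-trans (*-cong (≈-refl {c}) (%-≈ _)) (proj₂ (*-inverse c≉0))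

  ⁻¹-≉0 : ∀ {c} → c ≉ 0 → c ⁻¹ ≉ 0
  ⁻¹-≉0 {c} c≉0 c⁻¹≈0 = 1≉0 (begin
    1            ≈⟨ *-inverseʳ c≉0 ⟨
    c * c ⁻¹     ≈⟨ *-cong (≈-refl {c}) c⁻¹≈0 ⟩
    c * 0        ≡⟨ *-zeroʳ c ⟩
    0            ∎)

  *-cancelˡ : ∀ {a b} k → k ≉ 0 → k * a ≈ k * b → a ≈ b
  *-cancelˡ {a} {b} k k≉0 ka≈kb = begin
    a                   ≡⟨ *-identityˡ a ⟨
    1 * a               ≈⟨ *-cong (*-inverseʳ k≉0) (≈-refl {a}) ⟨
    k * k ⁻¹ * a        ≡⟨ solve 3 (λ k i a → k :* i :* a := i :* (k :* a)) refl k (k ⁻¹) a ⟩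
    k ⁻¹ * (k * a)      ≈⟨ *-cong (≈-refl {k ⁻¹}) ka≈kb ⟩
    k ⁻¹ * (k * b)      ≡⟨ solve 3 (λ k i b → i :* (k :* b) := k :* i :* b) refl k (k ⁻¹) b ⟩
    k * k ⁻¹ * b        ≈⟨ *-cong (*-inverseʳ k≉0) (≈-refl {b}) ⟩
    1 * b               ≡⟨ *-identityˡ b ⟩
    b                   ∎

  ⁻¹-involutive : ∀ {c} → c < p → c ⁻¹ ⁻¹ ≡ c
  ⁻¹-involutive {c} c<p = by-cases (c ≈? 0)
    where
    by-cases : Dec (c ≈ 0) → c ⁻¹ ⁻¹ ≡ c
    by-cases (yes c≈0) = trans (cong _⁻¹ (⁻¹-≈0 c≈0)) (trans (⁻¹-≈0 (≈-refl {0})) (sym (≈⇒≡ c<p 0<p c≈0)))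
    by-cases (no c≉0) = ≈⇒≡ (⁻¹<p _) c<p (*-cancelˡ (c ⁻¹) (⁻¹-≉0 c≉0) (begin
      c ⁻¹ * c ⁻¹ ⁻¹      ≈⟨ *-inverseʳ (⁻¹-≉0 c≉0) ⟩
      1                   ≈⟨ *-inverseʳ c≉0 ⟨
      c * c ⁻¹            ≡⟨ *-comm c (c ⁻¹) ⟩
      c ⁻¹ * c            ∎))

  ⁻¹-fixed : ∀ {c} → c < p → c ⁻¹ ≡ c → c ≡ 0 ⊎ c ≡ 1 ⊎ c ≡ pred p
  ⁻¹-fixed {c} c<p c⁻¹≡c = by-cases (c ≈? 0)
    where
    by-cases : Dec (c ≈ 0) → c ≡ 0 ⊎ c ≡ 1 ⊎ c ≡ pred p
    by-cases (yes c≈0) = inj₁ (≈⇒≡ c<p 0<p c≈0)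
    by-cases (no c≉0) = inj₂ (Sum.map (≈⇒≡ c<p 1<p) (λ c+1≈0 → ≈⇒≡ c<p pred-p<p (+-cancelʳ 1 (≈-trans c+1≈0 (≈-sym pred-p+1≈0))))
      (square-roots c 1 (begin
        c * c      ≡⟨ cong (c *_) c⁻¹≡c ⟨
        c * c ⁻¹   ≈⟨ *-inverseʳ c≉0 ⟩
        1 * 1      ∎)))

  ∑-affine : ∀ {k} c → k ≉ 0 → (f : ℕ → ℕ) → f Preserves _≈_ ⟶ _≡_ → ∑[ x < p ] f (k * x + c) ≡ ∑ p f
  ∑-affine {k} c k≉0 f f-cong =
    trans (∑-cong p (λ x _ → f-cong (≈-sym (%-≈ (k * x + c))))) (∑-bijection p σ τ (λ _ → m%n<n _ p) (λ _ → m%n<n _ p) τσ στ f)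
    where
    σ τ : ℕ → ℕ
    σ x = (k * x + c) % p
    τ y = (k ⁻¹ * (y + - c)) % p
    τσ : ∀ {x} → x < p → τ (σ x) ≡ x
    τσ {x} x<p = ≈⇒≡ (m%n<n _ p) x<p (begin
      τ (σ x)                       ≈⟨ %-≈ _ ⟩
      k ⁻¹ * (σ x + - c)            ≈⟨ *-cong (≈-refl {k ⁻¹}) (+-cong (%-≈ _) (≈-refl { - c})) ⟩
      k ⁻¹ * (k * x + c + - c)      ≡⟨ cong (k ⁻¹ *_) (+-assoc (k * x) c (- c)) ⟩
      k ⁻¹ * (k * x + (c + - c))    ≡⟨ solve 4 (λ i k x m → i :* (k :* x :+ m) := k :* i :* x :+ i :* m) refl (k ⁻¹) k x (c + - c) ⟩
      k * k ⁻¹ * x + k ⁻¹ * (c + - c) ≈⟨ +-cong (*-cong (*-inverseʳ k≉0) (≈-refl {x})) (*-cong (≈-refl {k ⁻¹}) (+-inverseʳ c)) ⟩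
      1 * x + k ⁻¹ * 0              ≡⟨ cong₂ _+_ (*-identityˡ x) (*-zeroʳ (k ⁻¹)) ⟩
      x + 0                         ≡⟨ +-identityʳ x ⟩
      x                             ∎)
    στ : ∀ {y} → y < p → σ (τ y) ≡ y
    στ {y} y<p = ≈⇒≡ (m%n<n _ p) y<p (begin
      σ (τ y)                       ≈⟨ %-≈ _ ⟩
      k * τ y + c                   ≈⟨ +-cong (*-cong (≈-refl {k}) (%-≈ _)) (≈-refl {c}) ⟩
      k * (k ⁻¹ * (y + - c)) + c    ≡⟨ solve 5 (λ k i y c m → k :* (i :* (y :+ m)) :+ c := k :* i :* (y :+ m) :+ c) refl k (k ⁻¹) y c (- c) ⟩
      k * k ⁻¹ * (y + - c) + c      ≈⟨ +-cong (*-cong (*-inverseʳ k≉0) (≈-refl {y + - c})) (≈-refl {c}) ⟩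
      1 * (y + - c) + c             ≡⟨ solve 3 (λ y m c → con 1 :* (y :+ m) :+ c := y :+ (c :+ m)) refl y (- c) c ⟩
      y + (c + - c)                 ≈⟨ +-cong (≈-refl {y}) (+-inverseʳ c) ⟩
      y + 0                         ≡⟨ +-identityʳ y ⟩
      y                             ∎)

  ⁻¹-unique : ∀ {c d} → c * d ≈ 1 → c ⁻¹ ≈ d
  ⁻¹-unique {c} {d} cd≈1 = *-cancelˡ c c≉0 (≈-trans (*-inverseʳ c≉0) (≈-sym cd≈1))
    where
    c≉0 : c ≉ 0
    c≉0 c≈0 = 1≉0 (begin
      1       ≈⟨ cd≈1 ⟨
      c * d   ≈⟨ *-cong c≈0 (≈-refl {d}) ⟩
      0 * d   ∎)

-- Counting squares in 𝔽_p

module Squares (p : ℕ) .{{_ : NonZero p}} (p-prime : Prime p) (p≢2 : p ≢ 2) where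

  open PrimeField p p-prime

  χ : ℕ → ℕ
  χ c = 𝟙 (isSquareMod? p c)

  roots : ℕ → ℕ
  roots c = ∑[ x < p ] 𝟙 (x * x ≈? c)

  IsSquareMod-resp : ∀ {c d} → c ≈ d → IsSquareMod p c → IsSquareMod p d
  IsSquareMod-resp (mod c%≡d%) (x , x²%≡c%) = x , trans x²%≡c% c%≡d%

  χ-cong : ∀ {c d} → c ≈ d → χ c ≡ χ d
  χ-cong c≈d = 𝟙-cong (isSquareMod? p _) (isSquareMod? p _) (mk⇔ (IsSquareMod-resp c≈d) (IsSquareMod-resp (≈-sym c≈d)))

  square-IsSquareMod : ∀ {x} → x < p → IsSquareMod p (x * x)
  square-IsSquareMod {x} x<p = fromℕ< x<p , cong (λ y → (y * y) % p) (toℕ-fromℕ< x<p)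

  χ-square : ∀ {x} → x < p → χ (x * x) ≡ 1
  χ-square x<p = 𝟙-yes (isSquareMod? p _) (square-IsSquareMod x<p)

  2≉0 : 2 ≉ 0
  2≉0 2≈0 = p≢2 (≤-antisym (∣⇒≤ (≈0⇒∣ 2≈0)) 1<p)

  ∑-𝟙-≈ : ∀ t → ∑[ x < p ] 𝟙 (x ≈? t) ≡ 1
  ∑-𝟙-≈ t = trans (∑-cong p (λ x x<p → 𝟙-cong (x ≈? t) (x ≟ t % p)
                     (mk⇔ (λ (mod x%≡t%) → trans (sym (<p⇒%≡ x<p)) x%≡t%) (λ x≡t% → mod (trans (<p⇒%≡ x<p) x≡t%)))))
                  (∑-𝟙-≟ (m%n<n t p))

  ∑-𝟙-linear : ∀ {k} → k ≉ 0 → ∀ c t → ∑[ x < p ] 𝟙 (k * x + c ≈? t) ≡ 1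
  ∑-𝟙-linear k≉0 c t = trans (∑-affine c k≉0 (λ y → 𝟙 (y ≈? t)) 𝟙≈-cong) (∑-𝟙-≈ t)
    where
    𝟙≈-cong : ∀ {x y} → x ≈ y → 𝟙 (x ≈? t) ≡ 𝟙 (y ≈? t)
    𝟙≈-cong x≈y = 𝟙-cong (_ ≈? t) (_ ≈? t) (mk⇔ (≈-trans (≈-sym x≈y)) (≈-trans x≈y))

  roots-≈0 : ∀ {c} → c ≈ 0 → roots c ≡ 1
  roots-≈0 {c} c≈0 = trans (∑-cong p (λ x x<p → 𝟙-cong (x * x ≈? c) (x ≟ 0) (mk⇔ (root x<p) (λ { refl → ≈-sym c≈0 }))))
                           (∑-𝟙-≟ 0<p)
    where
    root : ∀ {x} → x < p → x * x ≈ c → x ≡ 0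
    root {x} x<p x²≈c = ≈⇒≡ x<p 0<p (Sum.[ id , id ] (*-≈0 {x} (≈-trans x²≈c c≈0)))

  roots-nonsquare : ∀ {c} → ¬ IsSquareMod p c → roots c ≡ 0
  roots-nonsquare ¬□c = ∑-zero p (λ x x<p → 𝟙-no (_ ≈? _) (λ x²≈c → ¬□c (IsSquareMod-resp x²≈c (square-IsSquareMod x<p))))

  roots-square : ∀ {c} → c ≉ 0 → IsSquareMod p c → roots c ≡ 2
  roots-square {c} c≉0 (r , r²%≡c%) = begin
    roots c                                     ≡⟨ ∑-cong p (λ x x<p → 𝟙-⊎ (x * x ≈? c) (x ≟ x₀) (x ≟ - x₀) (x²≈c⇔ x<p) x₀≢-x₀) ⟩
    ∑[ x < p ] (𝟙 (x ≟ x₀) + 𝟙 (x ≟ - x₀))      ≡⟨ ∑-distrib-+ p (λ x → 𝟙 (x ≟ x₀)) (λ x → 𝟙 (x ≟ - x₀)) ⟩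
    ∑[ x < p ] 𝟙 (x ≟ x₀) + ∑[ x < p ] 𝟙 (x ≟ - x₀) ≡⟨ cong₂ _+_ (∑-𝟙-≟ x₀<p) (∑-𝟙-≟ -x₀<p) ⟩
    2                                           ∎
    where
    open ≡-Reasoning
    x₀ : ℕ
    x₀ = toℕ r
    x₀<p : x₀ < p
    x₀<p = toℕ<n r
    x₀²≈c : x₀ * x₀ ≈ c
    x₀²≈c = mod r²%≡c%
    x₀≉0 : x₀ ≉ 0
    x₀≉0 x₀≈0 = c≉0 (≈-trans (≈-sym x₀²≈c) (*-cong x₀≈0 x₀≈0))
    -x₀<p : - x₀ < p
    -x₀<p = -‿< x₀≉0
    x₀≢-x₀ : ∀ {x} → x ≡ x₀ → x ≢ - x₀
    x₀≢-x₀ refl x₀≡-x₀ = Sum.[ 2≉0 , x₀≉0 ] (*-≈0 {2} (≈-trans (≈-reflexive 2x₀≡x₀-x₀) (+-inverseʳ x₀)))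
      where
      2x₀≡x₀-x₀ : 2 * x₀ ≡ x₀ + - x₀
      2x₀≡x₀-x₀ = trans (cong (x₀ +_) (+-identityʳ x₀)) (cong (x₀ +_) x₀≡-x₀)
    x²≈c⇔ : ∀ {x} → x < p → (x * x ≈ c) ⇔ (x ≡ x₀ ⊎ x ≡ - x₀)
    x²≈c⇔ {x} x<p = mk⇔
      (λ x²≈c → Sum.map (≈⇒≡ x<p x₀<p) (λ x+x₀≈0 → ≈⇒≡ x<p -x₀<p (+-cancelʳ x₀ (≈-trans x+x₀≈0 (≈-sym (+-inverseˡ x₀)))))
                       (square-roots x x₀ (≈-trans x²≈c (≈-sym x₀²≈c))))
      λ { (inj₁ refl) → x₀²≈c ; (inj₂ refl) → ≈-trans (+≈0⇒square≈ { - x₀} (+-inverseˡ x₀)) x₀²≈c }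

  roots-≉0 : ∀ {c} → c ≉ 0 → roots c ≡ 2 * χ c
  roots-≉0 {c} c≉0 = by-cases (isSquareMod? p c)
    where
    by-cases : Dec (IsSquareMod p c) → roots c ≡ 2 * χ c
    by-cases (yes □c) = trans (roots-square c≉0 □c) (cong (2 *_) (sym (𝟙-yes (isSquareMod? p c) □c)))
    by-cases (no ¬□c) = trans (roots-nonsquare ¬□c) (cong (2 *_) (sym (𝟙-no (isSquareMod? p c) ¬□c)))

  roots+𝟙≈0 : ∀ c → roots c + 𝟙 (c ≈? 0) ≡ 2 * χ c
  roots+𝟙≈0 c = by-cases (c ≈? 0)
    where
    by-cases : Dec (c ≈ 0) → roots c + 𝟙 (c ≈? 0) ≡ 2 * χ c
    by-cases (yes c≈0) = trans (cong₂ _+_ (roots-≈0 c≈0) (𝟙-yes (c ≈? 0) c≈0))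
                               (cong (2 *_) (trans (sym (χ-square 0<p)) (χ-cong (≈-sym c≈0))))
    by-cases (no c≉0) = trans (cong (roots c +_) (𝟙-no (c ≈? 0) c≉0)) (trans (+-identityʳ _) (roots-≉0 c≉0))

  ∑-roots : ∑ p roots ≡ p
  ∑-roots = begin
    ∑[ c < p ] ∑[ x < p ] 𝟙 (x * x ≈? c)   ≡⟨ ∑-comm p p (λ c x → 𝟙 (x * x ≈? c)) ⟩
    ∑[ x < p ] ∑[ c < p ] 𝟙 (x * x ≈? c)   ≡⟨ ∑-cong p (λ x _ → trans (∑-cong p (λ c _ → 𝟙-cong (x * x ≈? c) (c ≈? x * x) (mk⇔ ≈-sym ≈-sym))) (∑-𝟙-≈ (x * x))) ⟩
    ∑[ x < p ] 1                           ≡⟨ ∑-const p 1 ⟩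
    p * 1                                  ≡⟨ *-identityʳ p ⟩
    p                                      ∎
    where open ≡-Reasoning

  2*∑χ≡p+1 : 2 * ∑ p χ ≡ p + 1
  2*∑χ≡p+1 = begin
    2 * ∑ p χ                              ≡⟨ *-distribˡ-∑ p 2 χ ⟩
    ∑[ c < p ] (2 * χ c)                   ≡⟨ ∑-cong p (λ c _ → roots+𝟙≈0 c) ⟨
    ∑[ c < p ] (roots c + 𝟙 (c ≈? 0))      ≡⟨ ∑-distrib-+ p roots (λ c → 𝟙 (c ≈? 0)) ⟩
    ∑ p roots + ∑[ c < p ] 𝟙 (c ≈? 0)      ≡⟨ cong₂ _+_ ∑-roots (∑-𝟙-≈ 0) ⟩
    p + 1                                  ∎
    where open ≡-Reasoning

  ∑-roots-a²+1 : ∑[ a < p ] roots (a * a + 1) ≡ pred p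
  ∑-roots-a²+1 = begin
    ∑[ a < p ] ∑[ x < p ] 𝟙 (x * x ≈? a * a + 1)       ≡⟨ ∑-cong p (λ a _ → substitute a) ⟩
    ∑[ a < p ] ∑[ u < p ] 𝟙 (2 * u * a + u * u ≈? 1)   ≡⟨ ∑-comm p p (λ a u → 𝟙 (2 * u * a + u * u ≈? 1)) ⟩
    ∑[ u < p ] ∑[ a < p ] 𝟙 (2 * u * a + u * u ≈? 1)   ≡⟨ ∑-pred p (λ u → ∑[ a < p ] 𝟙 (2 * u * a + u * u ≈? 1)) ⟩
    ∑[ a < p ] 𝟙 (0 ≈? 1) + ∑[ u < pred p ] ∑[ a < p ] 𝟙 (2 * suc u * a + suc u * suc u ≈? 1)
      ≡⟨ cong₂ _+_ (∑-zero p (λ _ _ → 𝟙-no (0 ≈? 1) (1≉0 ∘ ≈-sym)))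
                   (∑-cong (pred p) (λ u u<pred-p → ∑-𝟙-linear (2u≉0 u<pred-p) (suc u * suc u) 1)) ⟩
    ∑[ u < pred p ] 1                                   ≡⟨ ∑-const (pred p) 1 ⟩
    pred p * 1                                          ≡⟨ *-identityʳ (pred p) ⟩
    pred p                                              ∎
    where
    open ≡-Reasoning
    2u≉0 : ∀ {u} → u < pred p → 2 * suc u ≉ 0
    2u≉0 u<pred-p 2u≈0 = Sum.[ 2≉0 , 0<x<p⇒≉0 z<s (m≤pred[n]⇒suc[m]≤n u<pred-p) ] (*-≈0 {2} 2u≈0)
    -- x = u + a turns x² ≈ a² + 1 into an equation that is linear in a when u ≉ 0.
    substitute : ∀ a → ∑[ x < p ] 𝟙 (x * x ≈? a * a + 1) ≡ ∑[ u < p ] 𝟙 (2 * u * a + u * u ≈? 1)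
    substitute a = trans (sym (∑-affine a 1≉0 (λ x → 𝟙 (x * x ≈? a * a + 1)) square-cong))
                         (∑-cong p (λ u _ → 𝟙-cong (_ ≈? _) (_ ≈? _) (expand⇔ u)))
      where
      square-cong : ∀ {x y} → x ≈ y → 𝟙 (x * x ≈? a * a + 1) ≡ 𝟙 (y * y ≈? a * a + 1)
      square-cong x≈y = 𝟙-cong (_ ≈? _) (_ ≈? _) (mk⇔ (≈-trans (*-cong (≈-sym x≈y) (≈-sym x≈y))) (≈-trans (*-cong x≈y x≈y)))
      expand : ∀ u → (1 * u + a) * (1 * u + a) ≡ 2 * u * a + u * u + a * a
      expand u = solve 2 (λ u a → (con 1 :* u :+ a) :* (con 1 :* u :+ a) := con 2 :* u :* a :+ u :* u :+ a :* a) refl u a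
      expand⇔ : ∀ u → ((1 * u + a) * (1 * u + a) ≈ a * a + 1) ⇔ (2 * u * a + u * u ≈ 1)
      expand⇔ u = mk⇔
        (λ e → +-cancelʳ (a * a) (≈-trans (≈-reflexive (sym (expand u))) (≈-trans e (≈-reflexive (+-comm (a * a) 1)))))
        (λ e → ≈-trans (≈-reflexive (expand u)) (≈-trans (+-cong e (≈-refl {a * a})) (≈-reflexive (+-comm 1 (a * a)))))

  pred-p≉0 : pred p ≉ 0
  pred-p≉0 = 0<x<p⇒≉0 (<⇒≤pred 1<p) pred-p<p

  ∑-𝟙-a²+1≈0 : ∑[ a < p ] 𝟙 (a * a + 1 ≈? 0) ≡ 2 * χ (pred p)
  ∑-𝟙-a²+1≈0 = trans (∑-cong p (λ a _ → 𝟙-cong (_ ≈? 0) (_ ≈? pred p) (mk⇔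
                       (λ a²+1≈0 → +-cancelʳ {a * a} 1 (≈-trans a²+1≈0 (≈-sym pred-p+1≈0)))
                       (λ a²≈-1 → ≈-trans (+-cong {a * a} a²≈-1 (≈-refl {1})) pred-p+1≈0))))
                     (roots-≉0 pred-p≉0)

  2*∑χ[a²+1] : 2 * ∑[ a < p ] χ (a * a + 1) ≡ pred p + 2 * χ (pred p)
  2*∑χ[a²+1] = begin
    2 * ∑[ a < p ] χ (a * a + 1)                         ≡⟨ *-distribˡ-∑ p 2 (λ a → χ (a * a + 1)) ⟩
    ∑[ a < p ] (2 * χ (a * a + 1))                       ≡⟨ ∑-cong p (λ a _ → roots+𝟙≈0 (a * a + 1)) ⟨
    ∑[ a < p ] (roots (a * a + 1) + 𝟙 (a * a + 1 ≈? 0))  ≡⟨ ∑-distrib-+ p (λ a → roots (a * a + 1)) (λ a → 𝟙 (a * a + 1 ≈? 0)) ⟩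
    ∑[ a < p ] roots (a * a + 1) + ∑[ a < p ] 𝟙 (a * a + 1 ≈? 0) ≡⟨ cong₂ _+_ ∑-roots-a²+1 ∑-𝟙-a²+1≈0 ⟩
    pred p + 2 * χ (pred p)                              ∎
    where open ≡-Reasoning

  IsSquareMod-⁻¹ : ∀ {c} → IsSquareMod p c → IsSquareMod p (c ⁻¹)
  IsSquareMod-⁻¹ {c} (r , r²%≡c%) = by-cases (c ≈? 0)
    where
    x : ℕ
    x = toℕ r
    x²≈c : x * x ≈ c
    x²≈c = mod r²%≡c%
    by-cases : Dec (c ≈ 0) → IsSquareMod p (c ⁻¹)
    by-cases (yes c≈0) = subst (IsSquareMod p) (sym (⁻¹-≈0 c≈0)) (square-IsSquareMod 0<p)
    by-cases (no c≉0) = IsSquareMod-resp (≈-sym (⁻¹-unique c·x⁻²≈1)) (square-IsSquareMod (⁻¹<p x))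
      where
      x≉0 : x ≉ 0
      x≉0 x≈0 = c≉0 (≈-trans (≈-sym x²≈c) (*-cong x≈0 x≈0))
      c·x⁻²≈1 : c * (x ⁻¹ * x ⁻¹) ≈ 1
      c·x⁻²≈1 = ≈-trans (*-cong (≈-sym x²≈c) (≈-refl {x ⁻¹ * x ⁻¹}))
                (≈-trans (≈-reflexive (solve 2 (λ x y → x :* x :* (y :* y) := x :* y :* (x :* y)) refl x (x ⁻¹)))
                         (*-cong (*-inverseʳ x≉0) (*-inverseʳ x≉0)))

  χ-⁻¹ : ∀ {c} → c < p → χ (c ⁻¹) ≡ χ c
  χ-⁻¹ {c} c<p = 𝟙-cong (isSquareMod? p _) (isSquareMod? p c)
    (mk⇔ (subst (IsSquareMod p) (⁻¹-involutive c<p) ∘ IsSquareMod-⁻¹) IsSquareMod-⁻¹)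

  1⁻¹≡1 : 1 ⁻¹ ≡ 1
  1⁻¹≡1 = ≈⇒≡ (⁻¹<p 1) 1<p (⁻¹-unique (≈-refl {1}))

  pred-p⁻¹≡pred-p : pred p ⁻¹ ≡ pred p
  pred-p⁻¹≡pred-p = ≈⇒≡ (⁻¹<p (pred p)) pred-p<p (⁻¹-unique (≈-trans (+≈0⇒square≈ {pred p} pred-p+1≈0) (≈-refl {1})))

  𝟙-⁻¹-fixed : ∀ {c} → c < p → 𝟙 (c ⁻¹ ≟ c) ≡ 𝟙 (c ≟ 0) + (𝟙 (c ≟ 1) + 𝟙 (c ≟ pred p))
  𝟙-⁻¹-fixed {c} c<p =
    trans (𝟙-⊎ (c ⁻¹ ≟ c) (c ≟ 0) ((c ≟ 1) ⊎-dec (c ≟ pred p)) (mk⇔ (⁻¹-fixed c<p) fixed) 0≢1,pred-p)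
          (cong (𝟙 (c ≟ 0) +_) (𝟙-⊎ ((c ≟ 1) ⊎-dec (c ≟ pred p)) (c ≟ 1) (c ≟ pred p) (mk⇔ id id) 1≢pred-p))
    where
    fixed : c ≡ 0 ⊎ c ≡ 1 ⊎ c ≡ pred p → c ⁻¹ ≡ c
    fixed (inj₁ refl) = ⁻¹-≈0 (≈-refl {0})
    fixed (inj₂ (inj₁ refl)) = 1⁻¹≡1
    fixed (inj₂ (inj₂ refl)) = pred-p⁻¹≡pred-p
    1≢pred-p : c ≡ 1 → c ≢ pred p
    1≢pred-p refl 1≡pred-p = p≢2 (trans (sym (suc-pred p)) (cong suc (sym 1≡pred-p)))
    0≢1,pred-p : c ≡ 0 → ¬ (c ≡ 1 ⊎ c ≡ pred p)
    0≢1,pred-p refl (inj₁ ())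
    0≢1,pred-p refl (inj₂ 0≡pred-p) = pred-p≉0 (≈-reflexive (sym 0≡pred-p))

  ∑-χ-⁻¹-fixed : ∑[ c < p ] (𝟙 (c ⁻¹ ≟ c) * χ c) ≡ 2 + χ (pred p)
  ∑-χ-⁻¹-fixed = begin
    ∑[ c < p ] (𝟙 (c ⁻¹ ≟ c) * χ c)
      ≡⟨ ∑-cong p (λ c c<p → trans (cong (_* χ c) (𝟙-⁻¹-fixed c<p)) (distrib (𝟙 (c ≟ 0)) (𝟙 (c ≟ 1)) (𝟙 (c ≟ pred p)) (χ c))) ⟩
    ∑[ c < p ] (𝟙 (c ≟ 0) * χ c + (𝟙 (c ≟ 1) * χ c + 𝟙 (c ≟ pred p) * χ c))
      ≡⟨ ∑-distrib-+ p (λ c → 𝟙 (c ≟ 0) * χ c) (λ c → 𝟙 (c ≟ 1) * χ c + 𝟙 (c ≟ pred p) * χ c) ⟩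
    ∑[ c < p ] (𝟙 (c ≟ 0) * χ c) + ∑[ c < p ] (𝟙 (c ≟ 1) * χ c + 𝟙 (c ≟ pred p) * χ c)
      ≡⟨ cong (∑[ c < p ] (𝟙 (c ≟ 0) * χ c) +_) (∑-distrib-+ p (λ c → 𝟙 (c ≟ 1) * χ c) (λ c → 𝟙 (c ≟ pred p) * χ c)) ⟩
    ∑[ c < p ] (𝟙 (c ≟ 0) * χ c) + (∑[ c < p ] (𝟙 (c ≟ 1) * χ c) + ∑[ c < p ] (𝟙 (c ≟ pred p) * χ c))
      ≡⟨ cong₂ _+_ (∑-δ χ 0<p) (cong₂ _+_ (∑-δ χ 1<p) (∑-δ χ pred-p<p)) ⟩
    χ 0 + (χ 1 + χ (pred p))
      ≡⟨ cong₂ (λ x y → x + (y + χ (pred p))) (χ-square 0<p) (χ-square 1<p) ⟩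
    2 + χ (pred p) ∎
    where
    open ≡-Reasoning
    distrib : ∀ a b c x → (a + (b + c)) * x ≡ a * x + (b * x + c * x)
    distrib = solve 4 (λ a b c x → (a :+ (b :+ c)) :* x := a :* x :+ (b :* x :+ c :* x)) refl

  ∑-χ-parity : ∃ λ K → ∑ p χ ≡ 2 + χ (pred p) + 2 * K
  ∑-χ-parity = K , trans (∑-involution _⁻¹ (λ {c} _ → ⁻¹<p c) ⁻¹-involutive χ χ-⁻¹)
                         (cong (_+ 2 * K) ∑-χ-⁻¹-fixed)
    where
    K : ℕ
    K = ∑[ c < p ] (𝟙 (c <? c ⁻¹) * χ c)

  -- Rows with b = 0 and entries with a = 0 vanish by computation, shifting both indices down by one.
  N2≡∑-pairs : N2 p ≡ ∑[ b < pred p ] ∑[ a < b ] χ (suc a * suc b + 1)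
  N2≡∑-pairs = begin
    N2 p
      ≡⟨ length-filter-concatMap (isDiophantinePair? p) (λ b → map (λ a → (a , b)) (upTo b)) id p ⟩
    ∑[ b < p ] length (filter (isDiophantinePair? p) (map (λ a → (a , b)) (upTo b)))
      ≡⟨ ∑-cong p (λ b _ → trans (cong (length ∘ filter (isDiophantinePair? p)) (map-applyUpTo id (λ a → (a , b)) b))
                                  (length-filter-applyUpTo (isDiophantinePair? p) (λ a → (a , b)) b)) ⟩
    ∑[ b < p ] ∑[ a < b ] 𝟙 (isDiophantinePair? p (a , b))
      ≡⟨ ∑-pred p (λ b → ∑[ a < b ] 𝟙 (isDiophantinePair? p (a , b))) ⟩
    ∑[ b < pred p ] ∑[ a < b ] χ (suc a * suc b + 1) ∎
    where open ≡-Reasoning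

  ∑-row : ∀ {a} → a ≉ 0 → ∑[ b < pred p ] χ (a * suc b + 1) + 1 ≡ ∑ p χ
  ∑-row {a} a≉0 = begin
    ∑[ b < pred p ] χ (a * suc b + 1) + 1              ≡⟨ +-comm (∑[ b < pred p ] χ (a * suc b + 1)) 1 ⟩
    1 + ∑[ b < pred p ] χ (a * suc b + 1)              ≡⟨ cong (_+ ∑[ b < pred p ] χ (a * suc b + 1)) (trans (sym (χ-square 1<p)) (cong (λ z → χ (z + 1)) (sym (*-zeroʳ a)))) ⟩
    χ (a * 0 + 1) + ∑[ b < pred p ] χ (a * suc b + 1)  ≡⟨ ∑-pred p (λ b → χ (a * b + 1)) ⟨
    ∑[ b < p ] χ (a * b + 1)                           ≡⟨ ∑-affine 1 a≉0 χ χ-cong ⟩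
    ∑ p χ                                              ∎
    where open ≡-Reasoning

  ∑-diagonal : ∑[ a < pred p ] χ (suc a * suc a + 1) + 1 ≡ ∑[ a < p ] χ (a * a + 1)
  ∑-diagonal = begin
    ∑[ a < pred p ] χ (suc a * suc a + 1) + 1           ≡⟨ +-comm (∑[ a < pred p ] χ (suc a * suc a + 1)) 1 ⟩
    1 + ∑[ a < pred p ] χ (suc a * suc a + 1)           ≡⟨ cong (_+ ∑[ a < pred p ] χ (suc a * suc a + 1)) (χ-square 1<p) ⟨
    χ 1 + ∑[ a < pred p ] χ (suc a * suc a + 1)         ≡⟨ ∑-pred p (λ a → χ (a * a + 1)) ⟨
    ∑[ a < p ] χ (a * a + 1)                            ∎
    where open ≡-Reasoning

  N2-double-count : 2 * N2 p + ∑[ a < p ] χ (a * a + 1) + pred p ≡ pred p * ∑ p χ + 1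
  N2-double-count = begin
    2 * N2 p + ∑[ a < p ] χ (a * a + 1) + pred p        ≡⟨ cong (λ n → 2 * n + ∑[ a < p ] χ (a * a + 1) + pred p) N2≡∑-pairs ⟩
    2 * N + E + pred p                                  ≡⟨ cong (λ e → 2 * N + e + pred p) ∑-diagonal ⟨
    2 * N + (D + 1) + pred p                            ≡⟨ solve 4 (λ n d q one → con 2 :* n :+ (d :+ one) :+ q := (con 2 :* n :+ d) :+ q :+ one) refl N D (pred p) 1 ⟩
    2 * N + D + pred p + 1                              ≡⟨ cong (λ t → t + pred p + 1) (∑-triangle (pred p) g g-sym) ⟩
    ∑[ a < pred p ] ∑[ b < pred p ] g a b + pred p + 1  ≡⟨ cong (_+ 1) rows ⟩
    pred p * ∑ p χ + 1                                  ∎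
    where
    open ≡-Reasoning
    g : ℕ → ℕ → ℕ
    g a b = χ (suc a * suc b + 1)
    g-sym : ∀ a b → g a b ≡ g b a
    g-sym a b = cong (λ z → χ (z + 1)) (*-comm (suc a) (suc b))
    N D E : ℕ
    N = ∑[ b < pred p ] ∑[ a < b ] g a b
    D = ∑[ a < pred p ] g a a
    E = ∑[ a < p ] χ (a * a + 1)
    rows : ∑[ a < pred p ] ∑[ b < pred p ] g a b + pred p ≡ pred p * ∑ p χ
    rows = begin
      ∑[ a < pred p ] ∑[ b < pred p ] g a b + pred p
        ≡⟨ cong (∑[ a < pred p ] ∑[ b < pred p ] g a b +_) (trans (sym (*-identityʳ (pred p))) (sym (∑-const (pred p) 1))) ⟩
      ∑[ a < pred p ] ∑[ b < pred p ] g a b + ∑[ a < pred p ] 1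
        ≡⟨ ∑-distrib-+ (pred p) (λ a → ∑[ b < pred p ] g a b) (λ _ → 1) ⟨
      ∑[ a < pred p ] (∑[ b < pred p ] g a b + 1)
        ≡⟨ ∑-cong (pred p) (λ a a<pred-p → ∑-row (0<x<p⇒≉0 z<s (m≤pred[n]⇒suc[m]≤n a<pred-p))) ⟩
      ∑[ a < pred p ] ∑ p χ
        ≡⟨ ∑-const (pred p) (∑ p χ) ⟩
      pred p * ∑ p χ ∎

-- Solving the counting identities

halve : ∀ {x} y → 2 * x ≡ 2 * y → x ≡ y
halve {x} y = *-cancelˡ-≡ x y 2

2*-+-cancel : ∀ {x y} z → 2 * x + z ≡ 2 * y + z → x ≡ y
2*-+-cancel {x} {y} z e = halve y (+-cancelʳ-≡ z (2 * x) (2 * y) e)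

odd-prime-shape : ∀ {p Q} s K → 2 * Q ≡ p + 1 → Q ≡ 2 + s + 2 * K → p ≡ 3 + 2 * s + K * 4
odd-prime-shape {p} s K 2Q≡p+1 refl = +-cancelʳ-≡ 1 p _ (begin
  p + 1                     ≡⟨ 2Q≡p+1 ⟨
  2 * (2 + s + 2 * K)       ≡⟨ solve 2 (λ s K → con 2 :* (con 2 :+ s :+ con 2 :* K) := con 3 :+ con 2 :* s :+ K :* con 4 :+ con 1) refl s K ⟩
  3 + 2 * s + K * 4 + 1     ∎)
  where open ≡-Reasoning

shape-1mod4 : ∀ {p s} K → s ≡ 0 ⊎ s ≡ 1 → p ≡ 3 + 2 * s + K * 4 → p % 4 ≡ 1 → s ≡ 1 × p ≡ 5 + K * 4
shape-1mod4 K (inj₁ refl) refl p%4≡1 with trans (sym ([m+kn]%n≡m%n 3 K 4)) p%4≡1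
... | ()
shape-1mod4 K (inj₂ refl) refl _ = refl , refl

shape-3mod4 : ∀ {p s} K → s ≡ 0 ⊎ s ≡ 1 → p ≡ 3 + 2 * s + K * 4 → p % 4 ≡ 3 → s ≡ 0 × p ≡ 3 + K * 4
shape-3mod4 K (inj₁ refl) refl _ = refl , refl
shape-3mod4 K (inj₂ refl) refl p%4≡3 with trans (sym ([m+kn]%n≡m%n 5 K 4)) p%4≡3
... | ()

count-1mod4 : ∀ {p N Q E s} K → s ≡ 1 → p ≡ 5 + K * 4 → 2 * Q ≡ p + 1 → 2 * E ≡ pred p + 2 * s →
              2 * N + E + pred p ≡ pred p * Q + 1 → N ≡ ((p ∸ 1) * (p ∸ 2)) / 4
count-1mod4 {N = N} {Q} {E} K refl refl 2Q≡p+1 2E≡pred-p+2 hN = trans (2*-+-cancel (3 + 2 * K + (4 + K * 4)) (begin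
  2 * N + (3 + 2 * K + (4 + K * 4))   ≡⟨ +-assoc (2 * N) (3 + 2 * K) (4 + K * 4) ⟨
  2 * N + (3 + 2 * K) + (4 + K * 4)   ≡⟨ cong (λ e → 2 * N + e + (4 + K * 4)) E≡ ⟨
  2 * N + E + (4 + K * 4)             ≡⟨ hN ⟩
  (4 + K * 4) * Q + 1                 ≡⟨ cong (λ q → (4 + K * 4) * q + 1) Q≡ ⟩
  (4 + K * 4) * (3 + 2 * K) + 1       ≡⟨ solve 1 (λ K → (con 4 :+ K :* con 4) :* (con 3 :+ con 2 :* K) :+ con 1
                                                  := con 2 :* ((con 1 :+ K) :* (con 3 :+ K :* con 4)) :+ (con 3 :+ con 2 :* K :+ (con 4 :+ K :* con 4))) refl K ⟩
  2 * M + (3 + 2 * K + (4 + K * 4))   ∎)) (sym target)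
  where
  open ≡-Reasoning
  M : ℕ
  M = (1 + K) * (3 + K * 4)
  Q≡ : Q ≡ 3 + 2 * K
  Q≡ = halve (3 + 2 * K) (trans 2Q≡p+1 (solve 1 (λ K → con 5 :+ K :* con 4 :+ con 1 := con 2 :* (con 3 :+ con 2 :* K)) refl K))
  E≡ : E ≡ 3 + 2 * K
  E≡ = halve (3 + 2 * K) (trans 2E≡pred-p+2 (solve 1 (λ K → con 4 :+ K :* con 4 :+ con 2 :* con 1 := con 2 :* (con 3 :+ con 2 :* K)) refl K))
  target : ((4 + K * 4) * (3 + K * 4)) / 4 ≡ M
  target = trans (cong (_/ 4) (solve 1 (λ K → (con 4 :+ K :* con 4) :* (con 3 :+ K :* con 4) := (con 1 :+ K) :* (con 3 :+ K :* con 4) :* con 4) refl K)) (m*n/n≡m M 4)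

count-3mod4 : ∀ {p N Q E s} K → s ≡ 0 → p ≡ 3 + K * 4 → 2 * Q ≡ p + 1 → 2 * E ≡ pred p + 2 * s →
              2 * N + E + pred p ≡ pred p * Q + 1 → N ≡ ((p * p + 4) ∸ 3 * p) / 4
count-3mod4 {N = N} {Q} {E} K refl refl 2Q≡p+1 2E≡pred-p hN = trans (2*-+-cancel (1 + 2 * K + (2 + K * 4)) (begin
  2 * N + (1 + 2 * K + (2 + K * 4))   ≡⟨ +-assoc (2 * N) (1 + 2 * K) (2 + K * 4) ⟨
  2 * N + (1 + 2 * K) + (2 + K * 4)   ≡⟨ cong (λ e → 2 * N + e + (2 + K * 4)) E≡ ⟨
  2 * N + E + (2 + K * 4)             ≡⟨ hN ⟩
  (2 + K * 4) * Q + 1                 ≡⟨ cong (λ q → (2 + K * 4) * q + 1) Q≡ ⟩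
  (2 + K * 4) * (2 + 2 * K) + 1       ≡⟨ solve 1 (λ K → (con 2 :+ K :* con 4) :* (con 2 :+ con 2 :* K) :+ con 1
                                                  := con 2 :* (con 4 :* K :* K :+ con 3 :* K :+ con 1) :+ (con 1 :+ con 2 :* K :+ (con 2 :+ K :* con 4))) refl K ⟩
  2 * M + (1 + 2 * K + (2 + K * 4))   ∎)) (sym target)
  where
  open ≡-Reasoning
  p M : ℕ
  p = 3 + K * 4
  M = 4 * K * K + 3 * K + 1
  Q≡ : Q ≡ 2 + 2 * K
  Q≡ = halve (2 + 2 * K) (trans 2Q≡p+1 (solve 1 (λ K → con 3 :+ K :* con 4 :+ con 1 := con 2 :* (con 2 :+ con 2 :* K)) refl K))
  E≡ : E ≡ 1 + 2 * K
  E≡ = halve (1 + 2 * K) (trans 2E≡pred-p (solve 1 (λ K → con 2 :+ K :* con 4 :+ con 2 :* con 0 := con 2 :* (con 1 :+ con 2 :* K)) refl K))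
  target : ((p * p + 4) ∸ 3 * p) / 4 ≡ M
  target = trans (cong (λ x → (x ∸ 3 * p) / 4) (solve 1 (λ K → (con 3 :+ K :* con 4) :* (con 3 :+ K :* con 4) :+ con 4
                                                            := con 3 :* (con 3 :+ K :* con 4) :+ (con 4 :* K :* K :+ con 3 :* K :+ con 1) :* con 4) refl K))
                 (trans (cong (_/ 4) (m+n∸m≡n (3 * p) (M * 4))) (m*n/n≡m M 4))

proposition6p2 : (p : ℕ) .{{_ : NonZero p}} → Prime p → p ≢ 2 →
    ((p % 4 ≡ 1 → N2 p ≡ ((p ∸ 1) * (p ∸ 2)) / 4)
    × (p % 4 ≡ 3 → N2 p ≡ ((p * p + 4) ∸ 3 * p) / 4))
proposition6p2 p p-prime p≢2 = case-1mod4 , case-3mod4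
  where
  open Squares p p-prime p≢2
  K : ℕ
  K = proj₁ ∑-χ-parity
  p-shape : p ≡ 3 + 2 * χ (pred p) + K * 4
  p-shape = odd-prime-shape (χ (pred p)) K 2*∑χ≡p+1 (proj₂ ∑-χ-parity)
  χ[-1]∈01 : χ (pred p) ≡ 0 ⊎ χ (pred p) ≡ 1
  χ[-1]∈01 = 𝟙-0⊎1 (isSquareMod? p (pred p))
  case-1mod4 : p % 4 ≡ 1 → N2 p ≡ ((p ∸ 1) * (p ∸ 2)) / 4
  case-1mod4 p%4≡1 with shape-1mod4 K χ[-1]∈01 p-shape p%4≡1
  ... | χ[-1]≡1 , p≡5+4K = count-1mod4 K χ[-1]≡1 p≡5+4K 2*∑χ≡p+1 2*∑χ[a²+1] N2-double-count
  case-3mod4 : p % 4 ≡ 3 → N2 p ≡ ((p * p + 4) ∸ 3 * p) / 4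
  case-3mod4 p%4≡3 with shape-3mod4 K χ[-1]∈01 p-shape p%4≡3
  ... | χ[-1]≡0 , p≡3+4K = count-3mod4 K χ[-1]≡0 p≡3+4K 2*∑χ≡p+1 2*∑χ[a²+1] N2-double-count
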